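{- Let $b,j$ be positive integers and define, for $i\in\{0,1,\dots,b-1\}$, \[ f(i)=\left(\tfrac12\right)^{jb+2i+1}\binom{jb+2i}{i}. \] Then $f$ is monotonically increasing on $\{0,1,\dots,b-1\}$, i.e. $f(i+1)\ge f(i)$ for all $0\le i\le b-2$. -}

module Defs where

open import Data.Nat using (ℕ; zero; suc; _+_; _*_)
open import Data.Nat.Combinatorics using (_C_)
open import Data.Rational using (ℚ; ½; 1ℚ)
import Data.Rational as ℚ
import Data.Integer as ℤ

_^ℚ_ : ℚ → ℕ → ℚ
q ^ℚ zero  = 1ℚ
q ^ℚ suc n = q ℚ.* (q ^ℚ n)

f : (b j i : ℕ) → ℚ
f b j i = (½ ^ℚ (j * b + 2 * i + 1)) ℚ.* ((ℤ.+ ((j * b + 2 * i) C i)) ℚ./ 1)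

-- With n = j b + 2 i, the ratio f (i + 1) / f i equals C(n + 2, i + 1) / (4 C(n, i)).  Two
-- absorption identities give (i + 1)(n - i + 1) C(n + 2, i + 1) = (n + 2)(n + 1) C(n, i), so
-- monotonicity reduces to 4 (i + 1)(r + 1) ≤ (i + r + 2)(i + r + 1) for r = n - i; this is an
-- AM-GM inequality with slack, and it holds since i + 1 < b ≤ j b forces r ≥ 2 i + 2.
module Submission where

open import Defs
open import Data.Nat using (ℕ; zero; suc; _+_; _*_; _≤_; _<_; >-nonZero)
open import Data.Nat.Properties
open import Data.Nat.Combinatorics using (_C_; nC1≡n; nCk≡nC[n∸k]; nCk+nC[k+1]≡[n+1]C[k+1])
import Data.Nat.Coprimality as Coprimality
open import Data.Nat.Tactic.RingSolver using (solve-∀)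
open import Data.Integer using (+_)
import Data.Integer as ℤ
import Data.Integer.Properties as ℤ
open import Data.Rational using (½; _/_; NonNegative; toℚᵘ) renaming (_≤_ to _≤ℚ_)
import Data.Rational as ℚ
import Data.Rational.Properties as ℚ
import Data.Rational.Unnormalised as ℚᵘ
import Data.Rational.Unnormalised.Properties as ℚᵘ
import Data.Rational.Solver as ℚ-Solver
open import Data.Product using (_,_)
open import Relation.Binary.PropositionalEquality

[k+1]*[n+1]C[k+1]≡[n+1]*nCk : ∀ n k → suc k * (suc n C suc k) ≡ suc n * (n C k)
[k+1]*[n+1]C[k+1]≡[n+1]*nCk n zero = trans (+-identityʳ (suc n C 1)) (trans (nC1≡n (suc n)) (sym (*-identityʳ (suc n))))
[k+1]*[n+1]C[k+1]≡[n+1]*nCk zero (suc k) = *-zeroʳ (suc (suc k))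
[k+1]*[n+1]C[k+1]≡[n+1]*nCk (suc n) (suc k) = begin
  suc (suc k) * (suc (suc n) C suc (suc k))
    ≡⟨ cong (suc (suc k) *_) (nCk+nC[k+1]≡[n+1]C[k+1] (suc n) (suc k)) ⟨
  suc (suc k) * (suc n C suc k + suc n C suc (suc k))
    ≡⟨ *-distribˡ-+ (suc (suc k)) (suc n C suc k) _ ⟩
  suc n C suc k + suc k * (suc n C suc k) + suc (suc k) * (suc n C suc (suc k))
    ≡⟨ cong₂ (λ x y → suc n C suc k + x + y)
         ([k+1]*[n+1]C[k+1]≡[n+1]*nCk n k) ([k+1]*[n+1]C[k+1]≡[n+1]*nCk n (suc k)) ⟩
  suc n C suc k + suc n * (n C k) + suc n * (n C suc k)
    ≡⟨ regroup (suc n C suc k) (suc n) (n C k) (n C suc k) ⟩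
  suc n C suc k + suc n * (n C k + n C suc k)
    ≡⟨ cong (λ x → suc n C suc k + suc n * x) (nCk+nC[k+1]≡[n+1]C[k+1] n k) ⟩
  suc (suc n) * (suc n C suc k) ∎
  where
  open ≡-Reasoning
  regroup : ∀ a m x y → a + m * x + m * y ≡ a + m * (x + y)
  regroup = solve-∀

[k+r]Ck≡[k+r]Cr : ∀ k r → (k + r) C k ≡ (k + r) C r
[k+r]Ck≡[k+r]Cr k r = trans (nCk≡nC[n∸k] (m≤m+n k r)) (cong ((k + r) C_) (m+n∸m≡n k r))

[r+1]*[k+r+1]Ck≡[k+r+1]*[k+r]Ck : ∀ k r → suc r * (suc (k + r) C k) ≡ suc (k + r) * ((k + r) C k)
[r+1]*[k+r+1]Ck≡[k+r+1]*[k+r]Ck k r = begin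
  suc r * (suc (k + r) C k)       ≡⟨ cong (λ n → suc r * (n C k)) (+-suc k r) ⟨
  suc r * ((k + suc r) C k)       ≡⟨ cong (suc r *_) ([k+r]Ck≡[k+r]Cr k (suc r)) ⟩
  suc r * ((k + suc r) C suc r)   ≡⟨ cong (λ n → suc r * (n C suc r)) (+-suc k r) ⟩
  suc r * (suc (k + r) C suc r)   ≡⟨ [k+1]*[n+1]C[k+1]≡[n+1]*nCk (k + r) r ⟩
  suc (k + r) * ((k + r) C r)     ≡⟨ cong (suc (k + r) *_) ([k+r]Ck≡[k+r]Cr k r) ⟨
  suc (k + r) * ((k + r) C k)     ∎
  where open ≡-Reasoning

[k+1]*[r+1]*[k+r+2]C[k+1]≡[k+r+2]*[k+r+1]*[k+r]Ck : ∀ k r →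
  suc k * suc r * ((2 + (k + r)) C suc k) ≡ (2 + (k + r)) * suc (k + r) * ((k + r) C k)
[k+1]*[r+1]*[k+r+2]C[k+1]≡[k+r+2]*[k+r+1]*[k+r]Ck k r = begin
  suc k * suc r * (suc (suc n) C suc k)     ≡⟨ cong (_* (suc (suc n) C suc k)) (*-comm (suc k) (suc r)) ⟩
  suc r * suc k * (suc (suc n) C suc k)     ≡⟨ *-assoc (suc r) (suc k) _ ⟩
  suc r * (suc k * (suc (suc n) C suc k))   ≡⟨ cong (suc r *_) ([k+1]*[n+1]C[k+1]≡[n+1]*nCk (suc n) k) ⟩
  suc r * (suc (suc n) * (suc n C k))       ≡⟨ x*[y*z]≡y*[x*z] (suc r) (suc (suc n)) (suc n C k) ⟩
  suc (suc n) * (suc r * (suc n C k))       ≡⟨ cong (suc (suc n) *_) ([r+1]*[k+r+1]Ck≡[k+r+1]*[k+r]Ck k r) ⟩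
  suc (suc n) * (suc n * (n C k))           ≡⟨ *-assoc (suc (suc n)) (suc n) (n C k) ⟨
  suc (suc n) * suc n * (n C k)             ∎
  where
  open ≡-Reasoning
  n = k + r
  x*[y*z]≡y*[x*z] : ∀ x y z → x * (y * z) ≡ y * (x * z)
  x*[y*z]≡y*[x*z] = solve-∀

4*[k+1]*[r+1]≤[k+r+2]*[k+r+1] : ∀ k r → 2 * k + 2 ≤ r → 4 * (suc k * suc r) ≤ (2 + (k + r)) * suc (k + r)
4*[k+1]*[r+1]≤[k+r+2]*[k+r+1] k r 2k+2≤r with m≤n⇒∃[o]m+o≡n 2k+2≤r
... | e , refl = subst (4 * (suc k * suc (2 * k + 2 + e)) ≤_) (slack k e) (m≤m+n _ _)
  where
  slack : ∀ k e → 4 * (suc k * suc (2 * k + 2 + e)) + (k * k + k + e * (2 * k + 3) + e * e)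
                ≡ (2 + (k + (2 * k + 2 + e))) * suc (k + (2 * k + 2 + e))
  slack = solve-∀

4*[k+r]Ck≤[k+r+2]C[k+1] : ∀ k r → 2 * k + 2 ≤ r → 4 * ((k + r) C k) ≤ (2 + (k + r)) C suc k
4*[k+r]Ck≤[k+r+2]C[k+1] k r 2k+2≤r = *-cancelˡ-≤ (suc k * suc r) (begin
  suc k * suc r * (4 * ((k + r) C k))               ≡⟨ x*[4*y]≡4*x*y (suc k * suc r) ((k + r) C k) ⟩
  4 * (suc k * suc r) * ((k + r) C k)               ≤⟨ *-monoˡ-≤ ((k + r) C k) (4*[k+1]*[r+1]≤[k+r+2]*[k+r+1] k r 2k+2≤r) ⟩
  (2 + (k + r)) * suc (k + r) * ((k + r) C k)       ≡⟨ [k+1]*[r+1]*[k+r+2]C[k+1]≡[k+r+2]*[k+r+1]*[k+r]Ck k r ⟨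
  suc k * suc r * ((2 + (k + r)) C suc k)           ∎)
  where
  open ≤-Reasoning
  x*[4*y]≡4*x*y : ∀ x y → x * (4 * y) ≡ 4 * x * y
  x*[4*y]≡4*x*y = solve-∀

^ℚ-nonNeg : ∀ q .{{_ : NonNegative q}} n → NonNegative (q ^ℚ n)
^ℚ-nonNeg q zero    = _
^ℚ-nonNeg q (suc n) = ℚ.nonNeg*nonNeg⇒nonNeg q (q ^ℚ n) {{^ℚ-nonNeg q n}}

toℚᵘ-n/1 : ∀ n → toℚᵘ (+ n / 1) ≡ ℚᵘ.mkℚᵘ (+ n) 0
toℚᵘ-n/1 n = cong toℚᵘ (ℚ.normalize-coprime (Coprimality.sym (Coprimality.1-coprimeTo n)))

4*m≤n⇒m≤ᵘ½*[½*n] : ∀ m n → 4 * m ≤ n → ℚᵘ.mkℚᵘ (+ m) 0 ℚᵘ.≤ ℚᵘ.½ ℚᵘ.* (ℚᵘ.½ ℚᵘ.* ℚᵘ.mkℚᵘ (+ n) 0)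
4*m≤n⇒m≤ᵘ½*[½*n] m n 4m≤n = ℚᵘ.*≤* (begin
  + m ℤ.* + 4                      ≡⟨ ℤ.pos-* m 4 ⟨
  + (m * 4)                        ≤⟨ ℤ.+≤+ (subst (_≤ n) (*-comm 4 m) 4m≤n) ⟩
  + n                              ≡⟨ trans (ℤ.*-identityʳ _) (trans (ℤ.*-identityˡ _) (ℤ.*-identityˡ _)) ⟨
  (+ 1 ℤ.* (+ 1 ℤ.* + n)) ℤ.* + 1  ∎)
  where open ℤ.≤-Reasoning

4*m≤n⇒m/1≤½*[½*n/1] : ∀ m n → 4 * m ≤ n → + m / 1 ≤ℚ ½ ℚ.* (½ ℚ.* (+ n / 1))
4*m≤n⇒m/1≤½*[½*n/1] m n 4m≤n = ℚ.toℚᵘ-cancel-≤ (begin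
  toℚᵘ (+ m / 1)                                 ≡⟨ toℚᵘ-n/1 m ⟩
  ℚᵘ.mkℚᵘ (+ m) 0                                ≤⟨ 4*m≤n⇒m≤ᵘ½*[½*n] m n 4m≤n ⟩
  ℚᵘ.½ ℚᵘ.* (ℚᵘ.½ ℚᵘ.* ℚᵘ.mkℚᵘ (+ n) 0)          ≡⟨ cong (λ x → ℚᵘ.½ ℚᵘ.* (ℚᵘ.½ ℚᵘ.* x)) (toℚᵘ-n/1 n) ⟨
  ℚᵘ.½ ℚᵘ.* (ℚᵘ.½ ℚᵘ.* toℚᵘ (+ n / 1))           ≃⟨ ℚᵘ.*-congˡ {ℚᵘ.½} (ℚ.toℚᵘ-homo-* ½ (+ n / 1)) ⟨
  ℚᵘ.½ ℚᵘ.* toℚᵘ (½ ℚ.* (+ n / 1))               ≃⟨ ℚ.toℚᵘ-homo-* ½ (½ ℚ.* (+ n / 1)) ⟨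
  toℚᵘ (½ ℚ.* (½ ℚ.* (+ n / 1)))                 ∎)
  where open ℚᵘ.≤-Reasoning

½^m*c≤½^[2+m]*c′ : ∀ m c c′ → 4 * c ≤ c′ → ½ ^ℚ m ℚ.* (+ c / 1) ≤ℚ ½ ^ℚ (2 + m) ℚ.* (+ c′ / 1)
½^m*c≤½^[2+m]*c′ m c c′ 4c≤c′ = begin
  ½ ^ℚ m ℚ.* (+ c / 1)                     ≤⟨ ℚ.*-monoˡ-≤-nonNeg (½ ^ℚ m) {{^ℚ-nonNeg ½ m}} (4*m≤n⇒m/1≤½*[½*n/1] c c′ 4c≤c′) ⟩
  ½ ^ℚ m ℚ.* (½ ℚ.* (½ ℚ.* (+ c′ / 1)))    ≡⟨ x*[h*[h*y]]≡[h*[h*x]]*y ½ (½ ^ℚ m) (+ c′ / 1) ⟩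
  ½ ℚ.* (½ ℚ.* ½ ^ℚ m) ℚ.* (+ c′ / 1)      ∎
  where
  open ℚ.≤-Reasoning
  open ℚ-Solver.+-*-Solver
  x*[h*[h*y]]≡[h*[h*x]]*y : ∀ h x y → x ℚ.* (h ℚ.* (h ℚ.* y)) ≡ h ℚ.* (h ℚ.* x) ℚ.* y
  x*[h*[h*y]]≡[h*[h*x]]*y = solve 3 (λ h x y → x :* (h :* (h :* y)) := h :* (h :* x) :* y) refl

mainTheorem2 : (b j : ℕ) → 0 < b → 0 < j → (i : ℕ) → i + 1 < b → f b j i ≤ℚ f b j (i + 1)
mainTheorem2 b j _ 0<j i i+1<b = subst₂ _≤ℚ_ (sym f-i) (sym f-[i+1])
  (½^m*c≤½^[2+m]*c′ (i + r + 1) ((i + r) C i) ((2 + (i + r)) C suc i) (4*[k+r]Ck≤[k+r+2]C[k+1] i r 2i+2≤r))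
  where
  r = j * b + i
  f-i : f b j i ≡ ½ ^ℚ (i + r + 1) ℚ.* (+ ((i + r) C i) / 1)
  f-i = cong (λ n → ½ ^ℚ (n + 1) ℚ.* (+ (n C i) / 1)) (x+2i≡i+[x+i] (j * b) i)
    where
    x+2i≡i+[x+i] : ∀ x i → x + 2 * i ≡ i + (x + i)
    x+2i≡i+[x+i] = solve-∀
  f-[i+1] : f b j (i + 1) ≡ ½ ^ℚ (2 + (i + r + 1)) ℚ.* (+ ((2 + (i + r)) C suc i) / 1)
  f-[i+1] = cong₂ (λ n k → ½ ^ℚ (n + 1) ℚ.* (+ (n C k) / 1)) (x+2[i+1]≡2+i+[x+i] (j * b) i) (+-comm i 1)
    where
    x+2[i+1]≡2+i+[x+i] : ∀ x i → x + 2 * (i + 1) ≡ 2 + (i + (x + i))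
    x+2[i+1]≡2+i+[x+i] = solve-∀
  2i+2≤r : 2 * i + 2 ≤ r
  2i+2≤r = begin
    2 * i + 2        ≡⟨ 2i+2≡[i+2]+i i ⟩
    suc (i + 1) + i  ≤⟨ +-monoˡ-≤ i (≤-trans i+1<b (m≤n*m b j {{>-nonZero 0<j}})) ⟩
    j * b + i        ∎
    where
    open ≤-Reasoning
    2i+2≡[i+2]+i : ∀ i → 2 * i + 2 ≡ suc (i + 1) + i
    2i+2≡[i+2]+i = solve-∀
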